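{- Let $\mathbf X=(2+n,a,b,x_3,x_4,\ldots)$ be the frame of some Dyck path, with $n\ge 0$, and let $\mathbf Y=(2,a-n,b,x_3,x_4,\ldots)$ (the right progenitor of $\mathbf X$). If $k$ is the number of Dyck paths with frame $\mathbf Y$, then the number of Dyck paths with frame $\mathbf X$ is $$k\binom{a-1}{a-n-1}.$$
   Context: A Dyck path of length $2n$ is a lattice path from $(0,0)$ to $(2n,0)$ with steps $(1,1)$, $(1,-1)$ never going below the $x$-axis. The frame of a Dyck path is the eventually zero sequence $(i_0,i_1,\ldots)$ where $i_k$ is the number of vertices (including endpoints) at height $k$. -}

module Defs where

open import Data.Bool using (Bool; true; false; _∧_; if_then_else_)
open import Data.Nat using (ℕ; zero; suc; _+_; _∸_; _≡ᵇ_)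
open import Data.List using (List; []; _∷_; length; map; _++_)
open import Data.Nat.ListAction using (sum)
open import Data.Maybe using (Maybe; just; nothing)
open import Data.Product using (Σ; _×_; _,_)
open import Relation.Binary.PropositionalEquality using (_≡_)

-- A step: true = up (1,1), false = down (1,-1).
Step : Set
Step = Bool

Path : Set
Path = List Step

heightsFrom : ℕ → Path → Maybe (List ℕ)
heightsFrom h [] = just (h ∷ [])
heightsFrom h (true ∷ p) with heightsFrom (suc h) p
... | just hs = just (h ∷ hs)
... | nothing = nothing
heightsFrom zero (false ∷ p) = nothing
heightsFrom (suc h) (false ∷ p) with heightsFrom h p
... | just hs = just (suc h ∷ hs)
... | nothing = nothing

last : ℕ → List ℕ → ℕ
last d [] = d
last d (x ∷ xs) = last x xs

isDyck : Path → Bool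
isDyck p with heightsFrom 0 p
... | just hs = last 1 hs ≡ᵇ 0
... | nothing = false

IsDyck : Path → Set
IsDyck p = isDyck p ≡ true

countEq : ℕ → List ℕ → ℕ
countEq k [] = 0
countEq k (x ∷ xs) = (if x ≡ᵇ k then 1 else 0) + countEq k xs

-- the list of heights of all vertices (endpoints included); [] if not valid
vertexHeights : Path → List ℕ
vertexHeights p with heightsFrom 0 p
... | just hs = hs
... | nothing = []

frame : Path → ℕ → ℕ
frame p k = countEq k (vertexHeights p)

-- an eventually-zero sequence given by a finite list, padded with zeros
seq : List ℕ → ℕ → ℕ
seq [] k = 0
seq (x ∷ xs) zero = x
seq (x ∷ xs) (suc k) = seq xs k

HasFrame : Path → List ℕ → Set
HasFrame p X = ∀ k → frame p k ≡ seq X k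

-- decidable version: heights of a path of length L are ≤ L, so checking
-- k ≤ max(L, length X) suffices
upTo : ℕ → List ℕ
upTo zero = zero ∷ []
upTo (suc n) = upTo n ++ (suc n ∷ [])

allB : List Bool → Bool
allB [] = true
allB (b ∷ bs) = b ∧ allB bs

hasFrameB : Path → List ℕ → Bool
hasFrameB p X = allB (map (λ k → frame p k ≡ᵇ seq X k) (upTo (length p + length X)))

allPaths : ℕ → List Path
allPaths zero = [] ∷ []
allPaths (suc m) = map (true ∷_) (allPaths m) ++ map (false ∷_) (allPaths m)

-- number of Dyck paths with frame X: a path with frame X has sum X vertices,
-- hence length sum X ∸ 1
filterB : (Path → Bool) → List Path → List Path
filterB f [] = []
filterB f (x ∷ xs) = if f x then x ∷ filterB f xs else filterB f xs

numDyckWithFrame : List ℕ → ℕ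
numDyckWithFrame X =
  length (filterB (λ p → isDyck p ∧ hasFrameB p X) (allPaths (sum X ∸ 1)))

IsFrame : List ℕ → Set
IsFrame X = Σ Path (λ p → IsDyck p × HasFrame p X)

module Submission where

-- We count more general objects: walks with L steps from height h that end
-- at 0, never go below the axis and visit each height k exactly X_k times.
-- Their number `count h L X` is given by a recursion on the first step (pay
-- for the current vertex, then step up or down), and `count-correct` shows
-- that it agrees with the enumeration defining `numDyckWithFrame`.
-- From the recursion alone we derive vanishing criteria (wrong number of
-- vertices, too many visits to 0, no visit to 0) and the insertion lemma
-- `count-insert`: for walks from a height ≥ 1 visiting 0 only at the end and
-- 1 exactly c times, adding j visits to 0 and j to 1 multiplies the count by
-- C(c − 1 + j, j); the induction step is Pascal's rule.  A Dyck path with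
-- frame (2 + n, a, …) is an up step followed by such a walk from 1, so the
-- theorem is the case j = n, c = a − n together with binomial symmetry.

open import Defs
open import Data.Bool using (Bool; true; false; _∧_; if_then_else_)
open import Data.Bool.Properties using (T-≡; ∧-conicalˡ; ∧-conicalʳ; ¬-not)
open import Data.Nat using (ℕ; zero; suc; _+_; _*_; _∸_; _≡ᵇ_; _<_; _≤_; s≤s; z≤n)
open import Data.Nat.Properties
open import Data.Nat.ListAction using (sum)
open import Data.Nat.Combinatorics using (_C_; nCn≡1; nCk+nC[k+1]≡[n+1]C[k+1]; nCk≡nC[n∸k])
open import Data.Nat.Solver using (module +-*-Solver)
open import Data.List using (List; []; _∷_; length; map; _++_)
open import Data.List.Properties using (map-++)
open import Data.Maybe using (Maybe; just; nothing)
import Data.Maybe as Maybe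
open import Data.Product using (Σ; _×_; _,_; proj₁; proj₂)
open import Function.Bundles using (Equivalence)
open import Relation.Binary.PropositionalEquality
open import Relation.Nullary using (yes; no; contradiction)
open +-*-Solver

≡ᵇ-true⇒≡ : ∀ m n → (m ≡ᵇ n) ≡ true → m ≡ n
≡ᵇ-true⇒≡ m n e = ≡ᵇ⇒≡ m n (Equivalence.from T-≡ e)

≡⇒≡ᵇ-true : ∀ m n → m ≡ n → (m ≡ᵇ n) ≡ true
≡⇒≡ᵇ-true m n e = Equivalence.to T-≡ (≡⇒≡ᵇ m n e)

≢⇒≡ᵇ-false : ∀ m n → m ≢ n → (m ≡ᵇ n) ≡ false
≢⇒≡ᵇ-false m n m≢n = ¬-not (λ e → m≢n (≡ᵇ-true⇒≡ m n e))

∧-intro : ∀ {a b} → a ≡ true → b ≡ true → (a ∧ b) ≡ true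
∧-intro refl refl = refl

bool-ext : ∀ {a b : Bool} → (a ≡ true → b ≡ true) → (b ≡ true → a ≡ true) → a ≡ b
bool-ext {true}  {true}  _ _ = refl
bool-ext {true}  {false} f _ = sym (f refl)
bool-ext {false} {true}  _ g = g refl
bool-ext {false} {false} _ _ = refl

-- Budgets.  A list X read through `seq` is a finite multiset of heights;
-- `removeOne h X` removes one vertex at height h from it.

removeOne : ℕ → List ℕ → List ℕ
removeOne h       []       = []
removeOne zero    (x ∷ xs) = (x ∸ 1) ∷ xs
removeOne (suc h) (x ∷ xs) = x ∷ removeOne h xs

seq-removeOne-same : ∀ h X → seq (removeOne h X) h ≡ seq X h ∸ 1
seq-removeOne-same h       []      = refl
seq-removeOne-same zero    (x ∷ X) = refl
seq-removeOne-same (suc h) (x ∷ X) = seq-removeOne-same h X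

seq-removeOne-other : ∀ h X k → k ≢ h → seq (removeOne h X) k ≡ seq X k
seq-removeOne-other h       []      k       _   = refl
seq-removeOne-other zero    (x ∷ X) zero    k≢h = contradiction refl k≢h
seq-removeOne-other zero    (x ∷ X) (suc k) _   = refl
seq-removeOne-other (suc h) (x ∷ X) zero    _   = refl
seq-removeOne-other (suc h) (x ∷ X) (suc k) k≢h =
  seq-removeOne-other h X k (λ k≡h → k≢h (cong suc k≡h))

sum-removeOne : ∀ h X {m} → seq X h ≡ suc m → sum X ≡ suc (sum (removeOne h X))
sum-removeOne zero    (x ∷ X) refl = refl
sum-removeOne (suc h) (x ∷ X) e    =
  trans (cong (x +_) (sum-removeOne h X e)) (+-suc x _)

seq≤sum : ∀ X k → seq X k ≤ sum X
seq≤sum []      k       = z≤n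
seq≤sum (x ∷ X) zero    = m≤m+n x (sum X)
seq≤sum (x ∷ X) (suc k) = ≤-trans (seq≤sum X k) (m≤n+m (sum X) x)

sum≡0⇒seq≡0 : ∀ X k → sum X ≡ 0 → seq X k ≡ 0
sum≡0⇒seq≡0 X k e = n≤0⇒n≡0 (subst (seq X k ≤_) e (seq≤sum X k))

seq≡0⇒sum≡0 : ∀ X → (∀ k → seq X k ≡ 0) → sum X ≡ 0
seq≡0⇒sum≡0 []      _ = refl
seq≡0⇒sum≡0 (x ∷ X) z = cong₂ _+_ (z 0) (seq≡0⇒sum≡0 X (λ k → z (suc k)))

-- The counting function.  `count h L X` is the number of walks with L steps
-- from height h that end at height 0, never go below 0, and whose vertex
-- heights form exactly the budget X.

available : ℕ → ℕ → ℕ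
available zero    v = 0
available (suc _) v = v

count : ℕ → ℕ → List ℕ → ℕ
count zero    zero    X = available (seq X 0) (if sum (removeOne 0 X) ≡ᵇ 0 then 1 else 0)
count (suc h) zero    X = 0
count zero    (suc L) X = available (seq X 0) (count 1 L (removeOne 0 X))
count (suc h) (suc L) X = available (seq X (suc h))
  (count (suc (suc h)) L (removeOne (suc h) X) + count h L (removeOne (suc h) X))

stepFrom : ℕ → Step → Maybe ℕ
stepFrom h       true  = just (suc h)
stepFrom zero    false = nothing
stepFrom (suc h) false = just h

stepFrom-≤ : ∀ h b {h′} → stepFrom h b ≡ just h′ → h′ ≤ suc h
stepFrom-≤ h       true  refl = ≤-refl
stepFrom-≤ (suc h) false refl = m≤n⇒m≤1+n (n≤1+n h)

heightsFrom-step : ∀ h b p {h′} → stepFrom h b ≡ just h′ →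
  heightsFrom h (b ∷ p) ≡ Maybe.map (h ∷_) (heightsFrom h′ p)
heightsFrom-step h true p refl with heightsFrom (suc h) p
... | just hs = refl
... | nothing = refl
heightsFrom-step (suc h) false p refl with heightsFrom h p
... | just hs = refl
... | nothing = refl

heightsFrom-cons : ∀ h b p {hs} → heightsFrom h (b ∷ p) ≡ just hs →
  Σ ℕ λ h′ → stepFrom h b ≡ just h′ ×
    Σ (List ℕ) λ tl → heightsFrom h′ p ≡ just tl × hs ≡ h ∷ tl
heightsFrom-cons h true p e with heightsFrom (suc h) p in e′ | e
... | just tl | refl = suc h , refl , tl , e′ , refl
heightsFrom-cons (suc h) false p e with heightsFrom h p in e′ | e
... | just tl | refl = h , refl , tl , e′ , refl

heightsFrom-head : ∀ h p {hs} → heightsFrom h p ≡ just hs → Σ (List ℕ) λ tl → hs ≡ h ∷ tl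
heightsFrom-head h []      refl = [] , refl
heightsFrom-head h (b ∷ p) e with heightsFrom-cons h b p e
... | _ , _ , tl , _ , hs≡h∷tl = tl , hs≡h∷tl

last-heightsFrom : ∀ h p {hs} → heightsFrom h p ≡ just hs → ∀ x → last x hs ≡ last 1 hs
last-heightsFrom h p e x with heightsFrom-head h p e
... | tl , refl = refl

heightsFrom-bound : ∀ h p {hs} → heightsFrom h p ≡ just hs →
  ∀ k → h + length p < k → countEq k hs ≡ 0
heightsFrom-bound h [] refl k lt
  rewrite ≢⇒≡ᵇ-false h k (λ h≡k → <-irrefl h≡k (subst (_< k) (+-identityʳ h) lt)) = refl
heightsFrom-bound h (b ∷ p) e k lt with heightsFrom-cons h b p e
... | h′ , s , tl , e′ , refl
  rewrite ≢⇒≡ᵇ-false h k (λ h≡k → <-irrefl h≡k (≤-<-trans (m≤m+n h (suc (length p))) lt)) =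
  heightsFrom-bound h′ p e′ k (≤-<-trans bound lt)
  where
  bound : h′ + length p ≤ h + suc (length p)
  bound = subst (h′ + length p ≤_) (sym (+-suc h (length p)))
                (+-monoˡ-≤ (length p) (stepFrom-≤ h b s))

FrameOf : List ℕ → List ℕ → Set
FrameOf hs X = ∀ k → countEq k hs ≡ seq X k

FrameOf-[] : ∀ Y → FrameOf [] Y → sum Y ≡ 0
FrameOf-[] Y f = seq≡0⇒sum≡0 Y (λ k → sym (f k))

[]-FrameOf : ∀ Y → sum Y ≡ 0 → FrameOf [] Y
[]-FrameOf Y e k = sym (sum≡0⇒seq≡0 Y k e)

visit⇒ : ∀ h hs X → FrameOf (h ∷ hs) X →
  (Σ ℕ λ m → seq X h ≡ suc m) × FrameOf hs (removeOne h X)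
visit⇒ h hs X f = (countEq h hs , seq-h) , rest
  where
  head-same : (if h ≡ᵇ h then 1 else 0) ≡ 1
  head-same rewrite ≡⇒≡ᵇ-true h h refl = refl
  seq-h : seq X h ≡ suc (countEq h hs)
  seq-h = trans (sym (f h)) (cong (_+ countEq h hs) head-same)
  rest : FrameOf hs (removeOne h X)
  rest k with k ≟ h
  ... | yes refl = sym (trans (seq-removeOne-same k X) (cong (_∸ 1) seq-h))
  ... | no k≢h = begin
    countEq k hs                                        ≡⟨ cong (_+ countEq k hs) (sym head-other) ⟩
    (if h ≡ᵇ k then 1 else 0) + countEq k hs           ≡⟨ f k ⟩
    seq X k                                             ≡⟨ sym (seq-removeOne-other h X k k≢h) ⟩
    seq (removeOne h X) k                               ∎
    where
    open ≡-Reasoning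
    head-other : (if h ≡ᵇ k then 1 else 0) ≡ 0
    head-other rewrite ≢⇒≡ᵇ-false h k (λ h≡k → k≢h (sym h≡k)) = refl

visit⇐ : ∀ h hs X {m} → seq X h ≡ suc m → FrameOf hs (removeOne h X) → FrameOf (h ∷ hs) X
visit⇐ h hs X seq-h f k with k ≟ h
... | yes refl rewrite ≡⇒≡ᵇ-true k k refl | f k | seq-removeOne-same k X | seq-h = refl
... | no k≢h rewrite ≢⇒≡ᵇ-false h k (λ h≡k → k≢h (sym h≡k)) | f k =
  seq-removeOne-other h X k k≢h

Walk : ℕ → List ℕ → Path → Set
Walk h X p = Σ (List ℕ) λ hs → heightsFrom h p ≡ just hs × last 1 hs ≡ 0 × FrameOf hs X

walk-available : ∀ h X p → Walk h X p → Σ ℕ λ m → seq X h ≡ suc m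
walk-available h X p (hs , e , _ , f) with heightsFrom-head h p e
... | tl , refl = proj₁ (visit⇒ h tl X f)

walk-step⇒ : ∀ h b p X {h′} → stepFrom h b ≡ just h′ → Walk h X (b ∷ p) → Walk h′ (removeOne h X) p
walk-step⇒ h b p X s (hs , e , l , f) with heightsFrom-cons h b p e
... | h″ , s′ , tl , e′ , refl with trans (sym s) s′
... | refl = tl , e′ , trans (sym (last-heightsFrom h″ p e′ h)) l , proj₂ (visit⇒ h tl X f)

walk-step⇐ : ∀ h b p X {h′ m} → stepFrom h b ≡ just h′ → seq X h ≡ suc m →
  Walk h′ (removeOne h X) p → Walk h X (b ∷ p)
walk-step⇐ h b p X {h′} s seq-h (tl , e , l , f) =
  h ∷ tl , trans (heightsFrom-step h b p s) (cong (Maybe.map (h ∷_)) e) ,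
  trans (last-heightsFrom h′ p e h) l , visit⇐ h tl X seq-h f

walk-nil⇒ : ∀ X → Walk 0 X [] → sum (removeOne 0 X) ≡ 0
walk-nil⇒ X (_ , refl , _ , f) = FrameOf-[] (removeOne 0 X) (proj₂ (visit⇒ 0 [] X f))

walk-nil⇐ : ∀ X {m} → seq X 0 ≡ suc m → sum (removeOne 0 X) ≡ 0 → Walk 0 X []
walk-nil⇐ X seq-0 e = 0 ∷ [] , refl , refl , visit⇐ 0 [] X seq-0 ([]-FrameOf (removeOne 0 X) e)

allB-++ : ∀ xs ys → allB (xs ++ ys) ≡ (allB xs ∧ allB ys)
allB-++ []           ys = refl
allB-++ (true ∷ xs)  ys = allB-++ xs ys
allB-++ (false ∷ xs) ys = refl

allB-upTo⇒ : ∀ (f : ℕ → Bool) B → allB (map f (upTo B)) ≡ true → ∀ k → k ≤ B → f k ≡ true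
allB-upTo⇒ f zero    e zero z≤n = ∧-conicalˡ (f 0) true e
allB-upTo⇒ f (suc B) e k k≤
  rewrite map-++ f (upTo B) (suc B ∷ []) | allB-++ (map f (upTo B)) (f (suc B) ∷ []) with k ≟ suc B
... | yes refl = ∧-conicalˡ (f (suc B)) true (∧-conicalʳ (allB (map f (upTo B))) _ e)
... | no k≢   = allB-upTo⇒ f B (∧-conicalˡ _ _ e) k (≤-pred (≤∧≢⇒< k≤ k≢))

allB-upTo⇐ : ∀ (f : ℕ → Bool) B → (∀ k → k ≤ B → f k ≡ true) → allB (map f (upTo B)) ≡ true
allB-upTo⇐ f zero    t rewrite t 0 z≤n = refl
allB-upTo⇐ f (suc B) t
  rewrite map-++ f (upTo B) (suc B ∷ []) | allB-++ (map f (upTo B)) (f (suc B) ∷ []) =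
  ∧-intro (allB-upTo⇐ f B (λ k k≤ → t k (m≤n⇒m≤1+n k≤))) (∧-intro (t (suc B) ≤-refl) refl)

seq-beyond : ∀ X k → length X ≤ k → seq X k ≡ 0
seq-beyond []      k       _         = refl
seq-beyond (x ∷ X) (suc k) (s≤s le) = seq-beyond X k le

walkB : ℕ → List ℕ → Path → Bool
walkB h X p with heightsFrom h p
... | just hs = (last 1 hs ≡ᵇ 0) ∧ allB (map (λ k → countEq k hs ≡ᵇ seq X k) (upTo (h + length p + length X)))
... | nothing = false

-- The bounded test is faithful: heights beyond the bound are neither visited
-- (`heightsFrom-bound`) nor budgeted (`seq-beyond`).
walkB⇒Walk : ∀ h X p → walkB h X p ≡ true → Walk h X p
walkB⇒Walk h X p w with heightsFrom h p in e
... | just hs = hs , refl , ≡ᵇ-true⇒≡ _ _ (∧-conicalˡ _ _ w) , frame-ok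
  where
  B : ℕ
  B = h + length p + length X
  frame-ok : FrameOf hs X
  frame-ok k with k ≤? B
  ... | yes k≤B = ≡ᵇ-true⇒≡ _ _ (allB-upTo⇒ _ B (∧-conicalʳ _ _ w) k k≤B)
  ... | no k≰B = trans (heightsFrom-bound h p e k (≤-<-trans (m≤m+n (h + length p) (length X)) (≰⇒> k≰B)))
                       (sym (seq-beyond X k (≤-trans (m≤n+m (length X) (h + length p)) (<⇒≤ (≰⇒> k≰B)))))

Walk⇒walkB : ∀ h X p → Walk h X p → walkB h X p ≡ true
Walk⇒walkB h X p (hs , e , l , f) rewrite e =
  ∧-intro (≡⇒≡ᵇ-true _ _ l) (allB-upTo⇐ _ (h + length p + length X) (λ k _ → ≡⇒≡ᵇ-true _ _ (f k)))

dyck⇔walkB : ∀ X p → (isDyck p ∧ hasFrameB p X) ≡ walkB 0 X p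
dyck⇔walkB X p with heightsFrom 0 p
... | just hs = refl
... | nothing = refl

walkB-unavailable : ∀ h X p → seq X h ≡ 0 → walkB h X p ≡ false
walkB-unavailable h X p z =
  ¬-not (λ w → 0≢1+n (trans (sym z) (proj₂ (walk-available h X p (walkB⇒Walk h X p w)))))

walkB-step : ∀ h b p X {h′ m} → stepFrom h b ≡ just h′ → seq X h ≡ suc m →
  walkB h X (b ∷ p) ≡ walkB h′ (removeOne h X) p
walkB-step h b p X {h′} s seq-h = bool-ext
  (λ w → Walk⇒walkB h′ _ p (walk-step⇒ h b p X s (walkB⇒Walk h X (b ∷ p) w)))
  (λ w → Walk⇒walkB h X (b ∷ p) (walk-step⇐ h b p X s seq-h (walkB⇒Walk h′ _ p w)))

walkB-nil : ∀ X {m} → seq X 0 ≡ suc m → walkB 0 X [] ≡ (sum (removeOne 0 X) ≡ᵇ 0)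
walkB-nil X seq-0 = bool-ext
  (λ w → ≡⇒≡ᵇ-true _ 0 (walk-nil⇒ X (walkB⇒Walk 0 X [] w)))
  (λ e → Walk⇒walkB 0 X [] (walk-nil⇐ X seq-0 (≡ᵇ-true⇒≡ _ 0 e)))

#filter : (Path → Bool) → List Path → ℕ
#filter P ps = length (filterB P ps)

#filter-++ : ∀ P xs ys → #filter P (xs ++ ys) ≡ #filter P xs + #filter P ys
#filter-++ P []       ys = refl
#filter-++ P (x ∷ xs) ys with P x
... | true  = cong suc (#filter-++ P xs ys)
... | false = #filter-++ P xs ys

#filter-map : ∀ P (f : Path → Path) xs → #filter P (map f xs) ≡ #filter (λ p → P (f p)) xs
#filter-map P f []       = refl
#filter-map P f (x ∷ xs) with P (f x)
... | true  = cong suc (#filter-map P f xs)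
... | false = #filter-map P f xs

#filter-ext : ∀ P Q xs → (∀ p → P p ≡ Q p) → #filter P xs ≡ #filter Q xs
#filter-ext P Q []       e = refl
#filter-ext P Q (x ∷ xs) e rewrite e x with Q x
... | true  = cong suc (#filter-ext P Q xs e)
... | false = #filter-ext P Q xs e

#filter-none : ∀ P xs → (∀ p → P p ≡ false) → #filter P xs ≡ 0
#filter-none P []       e = refl
#filter-none P (x ∷ xs) e rewrite e x = #filter-none P xs e

#filter-allPaths : ∀ P L → #filter P (allPaths (suc L)) ≡
  #filter (λ p → P (true ∷ p)) (allPaths L) + #filter (λ p → P (false ∷ p)) (allPaths L)
#filter-allPaths P L = begin
  #filter P (map (true ∷_) (allPaths L) ++ map (false ∷_) (allPaths L))
    ≡⟨ #filter-++ P (map (true ∷_) (allPaths L)) _ ⟩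
  #filter P (map (true ∷_) (allPaths L)) + #filter P (map (false ∷_) (allPaths L))
    ≡⟨ cong₂ _+_ (#filter-map P (true ∷_) (allPaths L)) (#filter-map P (false ∷_) (allPaths L)) ⟩
  #filter (λ p → P (true ∷ p)) (allPaths L) + #filter (λ p → P (false ∷ p)) (allPaths L) ∎
  where open ≡-Reasoning

count-correct : ∀ h L X → #filter (walkB h X) (allPaths L) ≡ count h L X
count-correct zero zero X with seq X 0 in seq-0
... | zero  rewrite walkB-unavailable 0 X [] seq-0 = refl
... | suc m rewrite walkB-nil X seq-0 with sum (removeOne 0 X) ≡ᵇ 0
...   | true  = refl
...   | false = refl
count-correct (suc h) zero X = refl
count-correct h (suc L) X = trans (#filter-allPaths (walkB h X) L) (first-step h)
  where
  paths : List Path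
  paths = allPaths L
  unavailable : ∀ h b → seq X h ≡ 0 → #filter (λ p → walkB h X (b ∷ p)) paths ≡ 0
  unavailable h b z = #filter-none _ paths (λ p → walkB-unavailable h X (b ∷ p) z)
  step : ∀ h b {h′ m} → stepFrom h b ≡ just h′ → seq X h ≡ suc m →
    #filter (λ p → walkB h X (b ∷ p)) paths ≡ count h′ L (removeOne h X)
  step h b s seq-h = trans (#filter-ext _ _ paths (λ p → walkB-step h b p X s seq-h))
                           (count-correct _ L (removeOne h X))
  first-step : ∀ h → #filter (λ p → walkB h X (true ∷ p)) paths
                     + #filter (λ p → walkB h X (false ∷ p)) paths ≡ count h (suc L) X
  -- from height 0 only an up step is possible
  first-step zero with seq X 0 in seq-0
  ... | zero  = cong₂ _+_ (unavailable 0 true seq-0) (unavailable 0 false seq-0)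
  ... | suc m = trans (cong₂ _+_ (step 0 true refl seq-0) (#filter-none _ paths (λ _ → refl)))
                      (+-identityʳ _)
  first-step (suc h) with seq X (suc h) in seq-h
  ... | zero  = cong₂ _+_ (unavailable (suc h) true seq-h) (unavailable (suc h) false seq-h)
  ... | suc m = cong₂ _+_ (step (suc h) true refl seq-h) (step (suc h) false refl seq-h)

numDyck≡count : ∀ X → numDyckWithFrame X ≡ count 0 (sum X ∸ 1) X
numDyck≡count X = trans (#filter-ext _ (walkB 0 X) (allPaths (sum X ∸ 1)) (dyck⇔walkB X))
                        (count-correct 0 (sum X ∸ 1) X)

count-length : ∀ h L X → sum X ≢ suc L → count h L X ≡ 0
count-length zero zero X ne with seq X 0 in seq-0
... | zero  = refl
... | suc m rewrite ≢⇒≡ᵇ-false (sum (removeOne 0 X)) 0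
                      (λ e → ne (trans (sum-removeOne 0 X seq-0) (cong suc e))) = refl
count-length (suc h) zero X ne = refl
count-length zero (suc L) X ne with seq X 0 in seq-0
... | zero  = refl
... | suc m = count-length 1 L (removeOne 0 X) (λ e → ne (trans (sum-removeOne 0 X seq-0) (cong suc e)))
count-length (suc h) (suc L) X ne with seq X (suc h) in seq-h
... | zero  = refl
... | suc m = cong₂ _+_ (count-length (suc (suc h)) L (removeOne (suc h) X) ne′)
                        (count-length h L (removeOne (suc h) X) ne′)
  where
  ne′ : sum (removeOne (suc h) X) ≢ suc L
  ne′ e = ne (trans (sum-removeOne (suc h) X seq-h) (cong suc e))

-- Every visit to 0, except the start of a walk from 0, comes down from 1;
-- so a budget with too many zeros compared to ones admits no walk.
Excess : ℕ → List ℕ → Set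
Excess zero    X = suc (seq X 1) < seq X 0
Excess (suc _) X = seq X 1 < seq X 0

count-excess : ∀ h L X → Excess h X → count h L X ≡ 0
count-excess zero zero X t with seq X 0 in seq-0
... | zero  = refl
... | suc m = cong (λ b → if b then 1 else 0) (≢⇒≡ᵇ-false (sum Y) 0 (>⇒≢ (<-≤-trans 0<m m≤sumY)))
  where
  Y : List ℕ
  Y = removeOne 0 X
  0<m : 0 < m
  0<m = ≤-<-trans z≤n (≤-pred t)
  m≤sumY : m ≤ sum Y
  m≤sumY = subst (_≤ sum Y) (trans (seq-removeOne-same 0 X) (cong (_∸ 1) seq-0)) (seq≤sum Y 0)
count-excess zero (suc L) X t with seq X 0 in seq-0
... | zero  = refl
... | suc m = count-excess 1 L (removeOne 0 X)
  (subst₂ _<_ (sym (seq-removeOne-other 0 X 1 (λ ())))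
              (sym (trans (seq-removeOne-same 0 X) (cong (_∸ 1) seq-0))) (≤-pred t))
count-excess (suc h) zero X t = refl
count-excess (suc zero) (suc L) X t with seq X 1 in seq-1
... | zero  = refl
... | suc m = cong₂ _+_ (count-excess 2 L Y (subst₂ _<_ (sym ones) (sym zeros) (<-trans (n<1+n m) t)))
                        (count-excess 0 L Y (subst₂ (λ a b → suc a < b) (sym ones) (sym zeros) t))
  where
  Y : List ℕ
  Y = removeOne 1 X
  ones : seq Y 1 ≡ m
  ones = trans (seq-removeOne-same 1 X) (cong (_∸ 1) seq-1)
  zeros : seq Y 0 ≡ seq X 0
  zeros = seq-removeOne-other 1 X 0 (λ ())
count-excess (suc (suc h)) (suc L) X t with seq X (suc (suc h))
... | zero  = refl
... | suc m = cong₂ _+_ (count-excess (suc (suc (suc h))) L Y t′) (count-excess (suc h) L Y t′)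
  where
  Y : List ℕ
  Y = removeOne (suc (suc h)) X
  t′ : seq Y 1 < seq Y 0
  t′ = subst₂ _<_ (sym (seq-removeOne-other (suc (suc h)) X 1 (λ ())))
                  (sym (seq-removeOne-other (suc (suc h)) X 0 (λ ()))) t

count-noReturn : ∀ h L X → seq X 0 ≡ 0 → count h L X ≡ 0
count-noReturn zero    zero    X z rewrite z = refl
count-noReturn (suc h) zero    X z = refl
count-noReturn zero    (suc L) X z rewrite z = refl
count-noReturn (suc h) (suc L) X z with seq X (suc h)
... | zero  = refl
... | suc m = cong₂ _+_ (count-noReturn (suc (suc h)) L Y z′) (count-noReturn h L Y z′)
  where
  Y : List ℕ
  Y = removeOne (suc h) X
  z′ : seq Y 0 ≡ 0
  z′ = trans (seq-removeOne-other (suc h) X 0 (λ ())) z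

count-singleZero : ∀ L c R → count 0 L (1 ∷ suc c ∷ R) ≡ 0
count-singleZero zero    c R = refl
count-singleZero (suc L) c R = count-noReturn 1 L (0 ∷ suc c ∷ R) refl

available-* : ∀ m k v → available m (k * v) ≡ k * available m v
available-* zero    k v = sym (*-zeroʳ k)
available-* (suc m) k v = refl

-- Binomial bookkeeping for the inductive step of `count-insert`: after its
-- first visit to 1 the walk steps up (all j + 1 returns still to insert) or
-- down to 0 (one return spent).  In the base walk only one of the two
-- branches is nonempty (`count-excess`, `count-singleZero`), and Pascal's
-- rule combines the coefficients.
insert-pascal : ∀ L j c R →
  (((c ∸ 1) + suc j) C suc j) * count 2 L (1 ∷ c ∷ R) + ((c + j) C j) * count 1 (suc L) (1 ∷ suc c ∷ R)
  ≡ ((c + suc j) C suc j) * count 1 (suc L) (1 ∷ suc c ∷ R)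
insert-pascal L j zero R
  rewrite count-excess 2 L (1 ∷ 0 ∷ R) (s≤s z≤n) | nCn≡1 (suc j) | nCn≡1 j = refl
insert-pascal L j (suc c) R
  rewrite count-singleZero L c R | +-identityʳ (count 2 L (1 ∷ suc c ∷ R)) | +-suc c j = begin
    (n C suc j) * A + (n C j) * A   ≡⟨ sym (*-distribʳ-+ A (n C suc j) (n C j)) ⟩
    (n C suc j + n C j) * A         ≡⟨ cong (_* A) (+-comm (n C suc j) (n C j)) ⟩
    (n C j + n C suc j) * A         ≡⟨ cong (_* A) (nCk+nC[k+1]≡[n+1]C[k+1] n j) ⟩
    (suc n C suc j) * A             ∎
  where
  open ≡-Reasoning
  n : ℕ
  n = suc (c + j)
  A : ℕ
  A = count 2 L (1 ∷ suc c ∷ R)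

steps-+2 : ∀ L j → L + (suc j + suc j) ≡ suc (suc (L + (j + j)))
steps-+2 = solve 2 (λ L j → L :+ ((con 1 :+ j) :+ (con 1 :+ j)) := con 2 :+ (L :+ (j :+ j))) refl

too-many-vertices : ∀ j c s → suc j + (suc (c + j) + s) ≢ suc (j + j)
too-many-vertices j c s e = m≢1+m+n (suc (j + j)) (sym (trans (sym rearrange) e))
  where
  rearrange : suc j + (suc (c + j) + s) ≡ suc (suc (j + j) + (c + s))
  rearrange = solve 3 (λ j c s → (con 1 :+ j) :+ ((con 1 :+ (c :+ j)) :+ s)
                            := con 1 :+ ((con 1 :+ (j :+ j)) :+ (c :+ s))) refl j c s

-- Consider walks from a height ≥ 1 whose only visit to 0
-- is the final vertex and which visit 1 exactly c times.  Adding j further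
-- visits to 0 and j to 1 amounts to inserting j excursions 1 → 0 → 1 after
-- some of the first c − 1 visits to 1, with repetition: C(c − 1 + j, j) ways.
count-insert : ∀ L j h c R →
  count (suc h) (L + (j + j)) (suc j ∷ (c + j) ∷ R) ≡ (((c ∸ 1) + j) C j) * count (suc h) L (1 ∷ c ∷ R)
count-insert zero j h zero R =
  trans (count-excess (suc h) (j + j) (suc j ∷ j ∷ R) (n<1+n j)) (sym (*-zeroʳ ((0 + j) C j)))
count-insert zero j h (suc c) R =
  trans (count-length (suc h) (j + j) (suc j ∷ (suc c + j) ∷ R) (too-many-vertices j c (sum R)))
        (sym (*-zeroʳ ((c + j) C j)))
count-insert (suc L) j (suc h) c R = begin
  available (seq R h) (count (suc (suc (suc h))) (L + (j + j)) X′ + count (suc h) (L + (j + j)) X′)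
    ≡⟨ cong (available (seq R h)) (cong₂ _+_ (count-insert L j (suc (suc h)) c R′) (count-insert L j h c R′)) ⟩
  available (seq R h) (K * count (suc (suc (suc h))) L Y′ + K * count (suc h) L Y′)
    ≡⟨ cong (available (seq R h)) (sym (*-distribˡ-+ K _ _)) ⟩
  available (seq R h) (K * (count (suc (suc (suc h))) L Y′ + count (suc h) L Y′))
    ≡⟨ available-* (seq R h) K _ ⟩
  K * count (suc (suc h)) (suc L) (1 ∷ c ∷ R) ∎
  where
  open ≡-Reasoning
  K : ℕ
  K = ((c ∸ 1) + j) C j
  R′ X′ Y′ : List ℕ
  R′ = removeOne h R
  X′ = suc j ∷ (c + j) ∷ R′
  Y′ = 1 ∷ c ∷ R′
count-insert (suc L) j zero zero R =
  trans (count-excess 1 (suc L + (j + j)) (suc j ∷ j ∷ R) (n<1+n j)) (sym (*-zeroʳ ((0 + j) C j)))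
count-insert (suc L) zero zero (suc c) R
  rewrite +-identityʳ L | +-identityʳ c = sym (*-identityˡ _)
count-insert (suc L) (suc j) zero (suc c) R = begin
  count 2 (L + (suc j + suc j)) X′ + count 0 (L + (suc j + suc j)) X′
    ≡⟨ cong₂ _+_ (count-insert L (suc j) 1 c R) via-zero ⟩
  (((c ∸ 1) + suc j) C suc j) * count 2 L (1 ∷ c ∷ R) + ((c + j) C j) * count 1 (suc L) (1 ∷ suc c ∷ R)
    ≡⟨ insert-pascal L j c R ⟩
  ((c + suc j) C suc j) * count 1 (suc L) (1 ∷ suc c ∷ R) ∎
  where
  open ≡-Reasoning
  X′ : List ℕ
  X′ = suc (suc j) ∷ (c + suc j) ∷ R
  -- stepping down to 0 spends one of the inserted returns
  via-zero : count 0 (L + (suc j + suc j)) X′ ≡ ((c + j) C j) * count 1 (suc L) (1 ∷ suc c ∷ R)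
  via-zero rewrite steps-+2 L j | +-suc c j = count-insert (suc L) j 0 (suc c) R

steps-progenitor : ∀ n c s → n + ((c + n) + s) ≡ (c + s) + (n + n)
steps-progenitor = solve 3 (λ n c s → n :+ ((c :+ n) :+ s) := (c :+ s) :+ (n :+ n)) refl

-- The progenitor identity for the walk after the first step: with n ≤ a
-- the n extra returns are inserted, otherwise both sides vanish.
count-progenitor : ∀ n a s R →
  count 1 (n + (a + s)) (suc n ∷ a ∷ R) ≡ count 1 ((a ∸ n) + s) (1 ∷ (a ∸ n) ∷ R) * ((a ∸ 1) C (a ∸ n ∸ 1))
count-progenitor n a s R with n ≤? a
... | no n≰a rewrite m≤n⇒m∸n≡0 (<⇒≤ (≰⇒> n≰a)) =
  trans (count-excess 1 (n + (a + s)) (suc n ∷ a ∷ R) (s≤s (<⇒≤ (≰⇒> n≰a))))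
        (sym (cong (_* ((a ∸ 1) C 0)) (count-excess 1 s (1 ∷ 0 ∷ R) (s≤s z≤n))))
... | yes n≤a with a ∸ n | m∸n+n≡m n≤a
...   | c | refl = begin
  count 1 (n + ((c + n) + s)) (suc n ∷ (c + n) ∷ R) ≡⟨ cong (λ L → count 1 L (suc n ∷ (c + n) ∷ R)) (steps-progenitor n c s) ⟩
  count 1 ((c + s) + (n + n)) (suc n ∷ (c + n) ∷ R) ≡⟨ count-insert (c + s) n 0 c R ⟩
  (((c ∸ 1) + n) C n) * count 1 (c + s) (1 ∷ c ∷ R) ≡⟨ *-comm _ (count 1 (c + s) (1 ∷ c ∷ R)) ⟩
  count 1 (c + s) (1 ∷ c ∷ R) * (((c ∸ 1) + n) C n) ≡⟨ cong (count 1 (c + s) (1 ∷ c ∷ R) *_) (symmetric c) ⟩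
  count 1 (c + s) (1 ∷ c ∷ R) * ((c + n ∸ 1) C (c ∸ 1)) ∎
  where
  open ≡-Reasoning
  symmetric : ∀ c → ((c ∸ 1) + n) C n ≡ (c + n ∸ 1) C (c ∸ 1)
  symmetric zero    = nCn≡1 n
  symmetric (suc c) = trans (nCk≡nC[n∸k] (m≤n+m n c)) (cong ((c + n) C_) (m+n∸n≡m c n))

-- Theorem 14.  A Dyck path with frame X = (2 + n, a, b, …) starts with an
-- up step, after which it is a walk from 1 with budget (1 + n, a, b, …);
-- the same holds for Y = (2, a − n, b, …) with budget (1, a − n, b, …).
mainTheorem14 : (n a b : ℕ) (rest : List ℕ) →
    IsFrame ((2 + n) ∷ a ∷ b ∷ rest) →
    (k : ℕ) → numDyckWithFrame (2 ∷ (a ∸ n) ∷ b ∷ rest) ≡ k →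
    numDyckWithFrame ((2 + n) ∷ a ∷ b ∷ rest) ≡ k * ((a ∸ 1) C (a ∸ n ∸ 1))
mainTheorem14 n a b rest _ k refl = begin
  numDyckWithFrame ((2 + n) ∷ a ∷ b ∷ rest)
    ≡⟨ numDyck≡count ((2 + n) ∷ a ∷ b ∷ rest) ⟩
  count 1 (n + (a + sum R)) (suc n ∷ a ∷ R)
    ≡⟨ count-progenitor n a (sum R) R ⟩
  count 1 ((a ∸ n) + sum R) (1 ∷ (a ∸ n) ∷ R) * binomial
    ≡⟨ cong (_* binomial) (sym (numDyck≡count (2 ∷ (a ∸ n) ∷ b ∷ rest))) ⟩
  numDyckWithFrame (2 ∷ (a ∸ n) ∷ b ∷ rest) * binomial ∎
  where
  open ≡-Reasoning
  R : List ℕ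
  R = b ∷ rest
  binomial : ℕ
  binomial = (a ∸ 1) C (a ∸ n ∸ 1)
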